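{- Let $M$ be a finite set and $G$ a finite group acting on $M$ nontrivially and faithfully via $m\mapsto gm$. Then $G$ also acts on the set $\binom{M}{2}$ of unordered pairs via $g\{m,n\}=\{gm,gn\}$, and this action on pairs has at most $\binom{|M|}{2}-|M|+2$ orbits. Moreover, this bound is tight, and it is achieved if the image of $G$ in the symmetric group $\mathrm{Sym}(M)$ under the action is generated by a single transposition.
   Context: An action of $G$ on $M$ is a homomorphism $G\to\mathrm{Sym}(M)$; it is faithful if its kernel is trivial, and nontrivial if its image is not the trivial group. The orbit of $m$ is $\{gm: g\in G\}$. -}

module Defs where

open import Level using (Level; _⊔_)
open import Data.Nat using (ℕ; _+_; _∸_; _≤_)
open import Data.Nat.Combinatorics using (_C_)
open import Data.Fin using (Fin) renaming (_<_ to _<ᶠ_)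
open import Data.Fin.Permutation using (Permutation′; _⟨$⟩ʳ_; transpose)
open import Data.Product using (Σ; ∃; ∃-syntax; _×_; _,_)
open import Data.Sum using (_⊎_)
open import Data.List using (List; length)
open import Data.List.Relation.Unary.Any using (Any)
open import Data.List.Relation.Unary.All using (All)
open import Data.List.Relation.Unary.AllPairs using (AllPairs)
open import Algebra.Bundles using (Group)
open import Relation.Binary.PropositionalEquality using (_≡_; _≢_)
open import Relation.Nullary using (¬_)

IsFiniteGroup : ∀ {c ℓ} → Group c ℓ → Set (c ⊔ ℓ)
IsFiniteGroup G = ∃[ xs ] ∀ g → Any (g ≈_) xs
  where open Group G

record Action {c ℓ} (G : Group c ℓ) (n : ℕ) : Set (c ⊔ ℓ) where
  open Group G
  field
    act      : Carrier → Permutation′ n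
    act-cong : ∀ {g h} → g ≈ h → ∀ i → act g ⟨$⟩ʳ i ≡ act h ⟨$⟩ʳ i
    act-hom  : ∀ g h i → act (g ∙ h) ⟨$⟩ʳ i ≡ act g ⟨$⟩ʳ (act h ⟨$⟩ʳ i)

  ActsTrivially : Carrier → Set
  ActsTrivially g = ∀ i → act g ⟨$⟩ʳ i ≡ i

  Faithful : Set (c ⊔ ℓ)
  Faithful = ∀ g → ActsTrivially g → g ≈ ε

  Nontrivial : Set c
  Nontrivial = ∃[ g ] ¬ ActsTrivially g

-- Unordered pairs {a , b} of distinct elements of Fin n, stored with a < b.
record Pair (n : ℕ) : Set where
  constructor ⟪_,_∣_⟫
  field
    fst : Fin n
    snd : Fin n
    fst<snd : fst <ᶠ snd

module _ {c ℓ} {G : Group c ℓ} {n : ℕ} (A : Action G n) where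
  open Group G
  open Action A
  open Pair

  MapsPair : Carrier → Pair n → Pair n → Set
  MapsPair g p q =
    (act g ⟨$⟩ʳ fst p ≡ fst q × act g ⟨$⟩ʳ snd p ≡ snd q)
    ⊎ (act g ⟨$⟩ʳ fst p ≡ snd q × act g ⟨$⟩ʳ snd p ≡ fst q)

  SameOrbit : Pair n → Pair n → Set c
  SameOrbit p q = ∃[ g ] MapsPair g p q

  -- The action on pairs has exactly k orbits: there is a system of
  -- representatives of length k (pairwise in different orbits, covering every orbit).
  HasPairOrbitCount : ℕ → Set c
  HasPairOrbitCount k = ∃[ reps ]
    (length reps ≡ k
     × AllPairs (λ p q → ¬ SameOrbit p q) reps
     × (∀ q → Any (λ p → SameOrbit p q) reps))

  ImageGeneratedByTransposition : Set c
  ImageGeneratedByTransposition = ∃[ a ] ∃[ b ] (a ≢ b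
    × (∀ g → ActsTrivially g ⊎ (∀ i → act g ⟨$⟩ʳ i ≡ transpose a b ⟨$⟩ʳ i))
    × (∃[ g ] (∀ i → act g ⟨$⟩ʳ i ≡ transpose a b ⟨$⟩ʳ i)))

-- binom(|M|,2) - |M| + 2   (computed as (C(n,2) + 2) ∸ n to avoid truncation)
pairBound : ℕ → ℕ
pairBound n = (n C 2 + 2) ∸ n

-- Upper bound.  Pick g and a point a with b = g a ≠ a, and let S be the set
-- of pairs {a , x} with x ∉ {a , b}; |S| = n - 2.  The map `push` sending
-- p ∈ S to g p and fixing every other pair keeps each pair in its orbit and
-- never lands in S.  Hence it sends a system of orbit representatives R
-- injectively into the complement of S, so |R| + (n - 2) ≤ C(n,2).
--
-- Sharpness.  If the image of G is {id , (a b)}, then {a , b} together with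
-- all pairs avoiding b is a system of representatives: (a b) identifies
-- {a , x} with {b , x} and fixes every other pair.  There are
-- 1 + (C(n,2) - (n - 1)) of them.
module Submission where

open import Defs
open import Data.Nat using (ℕ; _≤_)
open import Data.Product using (_×_)
open import Algebra.Bundles using (Group)

open import Data.Nat using (zero; suc; _+_; _∸_; z≤n; s≤s)
open import Data.Nat.Properties
  using (+-suc; +-comm; m+n≤o⇒m≤o∸n; [m+n]∸[m+o]≡n∸o; m+n∸m≡n; ≤-antisym; module ≤-Reasoning)
open import Data.Nat.Combinatorics using (_C_; nC1≡n; nCk+nC[k+1]≡[n+1]C[k+1])
open import Data.Fin using (Fin) renaming (zero to fzero; suc to fsuc; _<_ to _<ᶠ_; _≟_ to _≟ᶠ_)
open import Data.Fin.Properties using (suc-injective; <-irrefl; <-asym; <-cmp; <-irrelevant; ¬∀⟶∃¬)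
import Data.Fin.Permutation.Components as Components
open import Data.Fin.Permutation using (_⟨$⟩ʳ_; _⟨$⟩ˡ_; transpose) renaming (inverseˡ to permutation-inverseˡ)
open import Data.Product using (∃; _,_; proj₁; proj₂)
open import Data.Sum using (_⊎_; inj₁; inj₂)
open import Data.List using (List; []; _∷_; _++_; length; map; filter; allFin)
open import Data.List.Properties using (length-++; length-map; length-tabulate)
open import Data.List.Membership.Propositional using (_∈_; _∉_; lose)
open import Data.List.Membership.Propositional.Properties
  using (∈-∃++; ∈-++⁻; ∈-++⁺ˡ; ∈-++⁺ʳ; ∈-map⁺; ∈-map⁻; ∈-filter⁺; ∈-filter⁻; ∈-allFin)
open import Data.List.Relation.Binary.Subset.Propositional using (_⊆_)
open import Data.List.Relation.Binary.Disjoint.Propositional using (Disjoint)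
open import Data.List.Relation.Unary.Any using (Any; here; there)
open import Data.List.Relation.Unary.All as All using (All; []; _∷_)
open import Data.List.Relation.Unary.AllPairs using (AllPairs; []; _∷_)
import Data.List.Relation.Unary.AllPairs as AllPairs
import Data.List.Relation.Unary.AllPairs.Properties as AllPairsₚ
open import Data.List.Relation.Unary.Unique.Propositional using (Unique)
import Data.List.Relation.Unary.Unique.Propositional.Properties as Uniqueₚ
open import Relation.Binary.Core using (Rel)
open import Relation.Binary.Definitions using (DecidableEquality; tri<; tri≈; tri>)
open import Relation.Binary.Structures using (IsEquivalence)
open import Relation.Binary.PropositionalEquality
  using (_≡_; _≢_; refl; sym; trans; cong; cong₂; subst; subst₂; module ≡-Reasoning)
open import Relation.Nullary using (¬_; Dec; yes; no; contradiction)
open import Relation.Nullary.Decidable using (_⊎-dec_; _×-dec_; ¬?; dec-true; dec-false)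
open import Relation.Unary using (Pred; Decidable)
open import Relation.Unary.Properties using (∁?)
open import Function using (_∘′_)

open Pair

-- Counting with duplicate-free lists

module _ {a} {A : Set a} where

  unique-⊆⇒length-≤ : ∀ {xs ys : List A} → Unique xs → xs ⊆ ys → length xs ≤ length ys
  unique-⊆⇒length-≤ {[]} _ _ = z≤n
  unique-⊆⇒length-≤ {x ∷ xs} (x∉xs ∷ xs!) x∷xs⊆ys with l , r , refl ← ∈-∃++ (x∷xs⊆ys (here refl)) =
    begin
      suc (length xs)       ≤⟨ s≤s (unique-⊆⇒length-≤ xs! xs⊆l++r) ⟩
      suc (length (l ++ r)) ≡⟨ removed-length ⟩
      length (l ++ x ∷ r)   ∎
    where
    open ≤-Reasoning
    xs⊆l++r : xs ⊆ l ++ r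
    xs⊆l++r y∈xs with ∈-++⁻ l (x∷xs⊆ys (there y∈xs))
    ... | inj₁ y∈l         = ∈-++⁺ˡ y∈l
    ... | inj₂ (here refl) = contradiction refl (All.lookup x∉xs y∈xs)
    ... | inj₂ (there y∈r) = ∈-++⁺ʳ l y∈r
    removed-length : suc (length (l ++ r)) ≡ length (l ++ x ∷ r)
    removed-length = trans (cong suc (length-++ l))
                     (trans (sym (+-suc (length l) (length r))) (sym (length-++ l)))

  same-elements⇒same-length : ∀ {xs ys : List A} → Unique xs → Unique ys →
                              xs ⊆ ys → ys ⊆ xs → length xs ≡ length ys
  same-elements⇒same-length xs! ys! xs⊆ys ys⊆xs =
    ≤-antisym (unique-⊆⇒length-≤ xs! xs⊆ys) (unique-⊆⇒length-≤ ys! ys⊆xs)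

  length-filter-∁ : ∀ {p} {P : Pred A p} (P? : Decidable P) (xs : List A) →
                    length (filter P? xs) + length (filter (∁? P?) xs) ≡ length xs
  length-filter-∁ P? [] = refl
  length-filter-∁ P? (x ∷ xs) with P? x
  ... | yes _ = cong suc (length-filter-∁ P? xs)
  ... | no  _ = trans (+-suc _ _) (cong suc (length-filter-∁ P? xs))

  length-remove : (_≟_ : DecidableEquality A) {xs : List A} {x : A} → Unique xs → x ∈ xs →
                  1 + length (filter (∁? (_≟ x)) xs) ≡ length xs
  length-remove _≟_ {xs} {x} xs! x∈xs = begin
      1 + length (filter (∁? (_≟ x)) xs)                        ≡⟨ cong (_+ length (filter (∁? (_≟ x)) xs)) only-x ⟨
      length (filter (_≟ x) xs) + length (filter (∁? (_≟ x)) xs) ≡⟨ length-filter-∁ (_≟ x) xs ⟩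
      length xs                                                  ∎
    where
    open ≡-Reasoning
    only-x : length (filter (_≟ x) xs) ≡ 1
    only-x = same-elements⇒same-length (Uniqueₚ.filter⁺ (_≟ x) xs!) ([] ∷ [])
      (λ y∈ → here (proj₂ (∈-filter⁻ (_≟ x) {xs = xs} y∈)))
      (λ { (here refl) → ∈-filter⁺ (_≟ x) x∈xs refl })

  map-unique : ∀ {b} {B : Set b} (f : A → B) {xs : List A} →
               (∀ {x y} → x ∈ xs → y ∈ xs → f x ≡ f y → x ≡ y) → Unique xs → Unique (map f xs)
  map-unique f injective [] = []
  map-unique f {x ∷ xs} injective (x∉xs ∷ xs!) =
    All.tabulate fx∉ ∷ map-unique f (λ x∈ y∈ → injective (there x∈) (there y∈)) xs!
    where
    fx∉ : ∀ {z} → z ∈ map f xs → f x ≢ z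
    fx∉ z∈ fx≡z with y , y∈xs , refl ← ∈-map⁻ f z∈ =
      All.lookup x∉xs y∈xs (injective (here refl) (there y∈xs) fx≡z)

-- Counting classes of an equivalence relation

module _ {a ℓ} {A : Set a} {_~_ : Rel A ℓ} (~-equivalence : IsEquivalence _~_) where
  open IsEquivalence ~-equivalence renaming (sym to ~-sym; trans to ~-trans)

  classes+avoided≤ : ∀ {R S U : List A} (push : A → A) →
                     (∀ x → x ~ push x) → (∀ x → push x ∉ S) →
                     AllPairs (λ x y → ¬ x ~ y) R → Unique S → (∀ x → x ∈ U) →
                     length R + length S ≤ length U
  classes+avoided≤ {R} {S} {U} push stays avoids R-separated S! complete = begin
      length R + length S            ≡⟨ cong (_+ length S) (length-map push R) ⟨
      length (map push R) + length S ≡⟨ length-++ (map push R) ⟨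
      length (map push R ++ S)       ≤⟨ unique-⊆⇒length-≤ pushed-unique (λ {x} _ → complete x) ⟩
      length U                       ∎
    where
    open ≤-Reasoning
    separates : ∀ {x y} → ¬ x ~ y → push x ≢ push y
    separates {x} {y} x≁y eq = x≁y (~-trans (stays x) (subst (_~ y) (sym eq) (~-sym (stays y))))
    disjoint : Disjoint (map push R) S
    disjoint (z∈pushed , z∈S) with x , _ , refl ← ∈-map⁻ push z∈pushed = avoids x z∈S
    pushed-unique : Unique (map push R ++ S)
    pushed-unique = Uniqueₚ.++⁺ (AllPairsₚ.map⁺ (AllPairs.map separates R-separated)) S! disjoint

  unique⇒separated : ∀ {p} {P : Pred A p} {xs : List A} →
                     (∀ {x y} → P x → P y → x ~ y → x ≡ y) →
                     All P xs → Unique xs → AllPairs (λ x y → ¬ x ~ y) xs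
  unique⇒separated rigid [] [] = []
  unique⇒separated rigid (px ∷ pxs) (x∉xs ∷ xs!) =
    All.zipWith (λ (x≢y , py) x~y → x≢y (rigid px py x~y)) (x∉xs , pxs)
    ∷ unique⇒separated rigid pxs xs!

-- Unordered pairs of points of Fin n

module _ {n : ℕ} where

  infix 4 _≐⟅_,_⟆ _∈ᵖ_
  data _≐⟅_,_⟆ (q : Pair n) (x y : Fin n) : Set where
    in-order : x ≡ fst q → y ≡ snd q → q ≐⟅ x , y ⟆
    reversed : x ≡ snd q → y ≡ fst q → q ≐⟅ x , y ⟆

  _∈ᵖ_ : Fin n → Pair n → Set
  x ∈ᵖ q = x ≡ fst q ⊎ x ≡ snd q

  _∈ᵖ?_ : ∀ x q → Dec (x ∈ᵖ q)
  x ∈ᵖ? q = (x ≟ᶠ fst q) ⊎-dec (x ≟ᶠ snd q)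

  fst≢snd : (q : Pair n) → fst q ≢ snd q
  fst≢snd q eq = <-irrefl eq (fst<snd q)

  -- The order proof is irrelevant, so a pair is determined by its two points.
  pair-≡ : ∀ {p q : Pair n} → fst p ≡ fst q → snd p ≡ snd q → p ≡ q
  pair-≡ {⟪ x , y ∣ x<y ⟫} {⟪ _ , _ ∣ x<y′ ⟫} refl refl = cong ⟪ x , y ∣_⟫ (<-irrelevant x<y x<y′)

  _≟ᵖ_ : DecidableEquality (Pair n)
  p ≟ᵖ q with fst p ≟ᶠ fst q | snd p ≟ᶠ snd q
  ... | yes fst≡ | yes snd≡ = yes (pair-≡ fst≡ snd≡)
  ... | no  fst≢ | _        = no (λ p≡q → fst≢ (cong fst p≡q))
  ... | yes _    | no  snd≢ = no (λ p≡q → snd≢ (cong snd p≡q))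

  ≐-refl : (q : Pair n) → q ≐⟅ fst q , snd q ⟆
  ≐-refl q = in-order refl refl

  ≐-swap : ∀ {q x y} → q ≐⟅ x , y ⟆ → q ≐⟅ y , x ⟆
  ≐-swap (in-order x≡ y≡) = reversed y≡ x≡
  ≐-swap (reversed x≡ y≡) = in-order y≡ x≡

  ≐-distinct : ∀ {q x y} → q ≐⟅ x , y ⟆ → x ≢ y
  ≐-distinct {q} (in-order refl refl) = fst≢snd q
  ≐-distinct {q} (reversed refl refl) = fst≢snd q ∘′ sym

  ≐-∈ᵖ : ∀ {q x y} → q ≐⟅ x , y ⟆ → x ∈ᵖ q
  ≐-∈ᵖ (in-order x≡ _) = inj₁ x≡
  ≐-∈ᵖ (reversed x≡ _) = inj₂ x≡

  ≐-points : ∀ {q x y z} → q ≐⟅ x , y ⟆ → z ∈ᵖ q → z ≡ x ⊎ z ≡ y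
  ≐-points (in-order refl refl) (inj₁ refl) = inj₁ refl
  ≐-points (in-order refl refl) (inj₂ refl) = inj₂ refl
  ≐-points (reversed refl refl) (inj₁ refl) = inj₂ refl
  ≐-points (reversed refl refl) (inj₂ refl) = inj₁ refl

  ≐-injective : ∀ {p q x y} → p ≐⟅ x , y ⟆ → q ≐⟅ x , y ⟆ → p ≡ q
  ≐-injective (in-order refl refl) (in-order fst≡ snd≡) = pair-≡ fst≡ snd≡
  ≐-injective (reversed refl refl) (reversed snd≡ fst≡) = pair-≡ fst≡ snd≡
  ≐-injective {p} {q} (in-order refl refl) (reversed snd≡ fst≡) =
    contradiction (subst₂ _<ᶠ_ (sym fst≡) (sym snd≡) (fst<snd q)) (<-asym (fst<snd p))
  ≐-injective {p} {q} (reversed refl refl) (in-order snd≡ fst≡) =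
    contradiction (subst₂ _<ᶠ_ (sym snd≡) (sym fst≡) (fst<snd q)) (<-asym (fst<snd p))

  ∈ᵖ-both : ∀ {q x y} → x ∈ᵖ q → y ∈ᵖ q → x ≢ y → q ≐⟅ x , y ⟆
  ∈ᵖ-both (inj₁ refl) (inj₁ refl) x≢y = contradiction refl x≢y
  ∈ᵖ-both (inj₁ refl) (inj₂ refl) _   = in-order refl refl
  ∈ᵖ-both (inj₂ refl) (inj₁ refl) _   = reversed refl refl
  ∈ᵖ-both (inj₂ refl) (inj₂ refl) x≢y = contradiction refl x≢y

  ≐-image : ∀ (f : Fin n → Fin n) {q r x y} →
            q ≐⟅ x , y ⟆ → r ≐⟅ f (fst q) , f (snd q) ⟆ → r ≐⟅ f x , f y ⟆
  ≐-image f (in-order refl refl) r≐ = r≐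
  ≐-image f (reversed refl refl) r≐ = ≐-swap r≐

  ≐-image⁻ : ∀ (f : Fin n → Fin n) {q r x y} →
             q ≐⟅ x , y ⟆ → r ≐⟅ f x , f y ⟆ → r ≐⟅ f (fst q) , f (snd q) ⟆
  ≐-image⁻ f (in-order refl refl) r≐ = r≐
  ≐-image⁻ f (reversed refl refl) r≐ = ≐-swap r≐

  ≐-image-∈ᵖ : ∀ (f : Fin n → Fin n) {q r x} → r ≐⟅ f (fst q) , f (snd q) ⟆ → x ∈ᵖ q → f x ∈ᵖ r
  ≐-image-∈ᵖ f r≐ (inj₁ refl) = ≐-∈ᵖ r≐
  ≐-image-∈ᵖ f r≐ (inj₂ refl) = ≐-∈ᵖ (≐-swap r≐)

  ⟅_,_⟆ : (x y : Fin n) → x ≢ y → Pair n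
  ⟅ x , y ⟆ x≢y with <-cmp x y
  ... | tri< x<y _ _ = ⟪ x , y ∣ x<y ⟫
  ... | tri≈ _ x≡y _ = contradiction x≡y x≢y
  ... | tri> _ _ y<x = ⟪ y , x ∣ y<x ⟫

  ⟅,⟆-≐ : ∀ x y (x≢y : x ≢ y) → ⟅ x , y ⟆ x≢y ≐⟅ x , y ⟆
  ⟅,⟆-≐ x y x≢y with <-cmp x y
  ... | tri< _ _ _   = in-order refl refl
  ... | tri≈ _ x≡y _ = contradiction x≡y x≢y
  ... | tri> _ _ _   = reversed refl refl

  partner : Fin n → Pair n → Fin n
  partner a q with a ≟ᶠ fst q
  ... | yes _ = snd q
  ... | no  _ = fst q

  partner-≐ : ∀ {a q} → a ∈ᵖ q → q ≐⟅ a , partner a q ⟆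
  partner-≐ {a} {q} a∈q with a ≟ᶠ fst q | a∈q
  ... | yes a≡fst | _          = in-order a≡fst refl
  ... | no  a≢fst | inj₁ a≡fst = contradiction a≡fst a≢fst
  ... | no  _     | inj₂ a≡snd = reversed a≡snd refl

  partner-unique : ∀ {a q x} → q ≐⟅ a , x ⟆ → partner a q ≡ x
  partner-unique {a} {q} q≐ with a ≟ᶠ fst q | q≐
  ... | yes _      | in-order _ refl    = refl
  ... | yes a≡fst  | reversed a≡snd _   = contradiction (trans (sym a≡fst) a≡snd) (fst≢snd q)
  ... | no  a≢fst  | in-order a≡fst _   = contradiction a≡fst a≢fst
  ... | no  _      | reversed _ refl    = refl

-- Enumeration of all pairs

-- Pairs of Fin (suc n) are {0 , j + 1} or the lift of a pair of Fin n.
pairWithZero : ∀ {n} → Fin n → Pair (suc n)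
pairWithZero j = ⟪ fzero , fsuc j ∣ s≤s z≤n ⟫

liftPair : ∀ {n} → Pair n → Pair (suc n)
liftPair ⟪ x , y ∣ x<y ⟫ = ⟪ fsuc x , fsuc y ∣ s≤s x<y ⟫

allPairs : ∀ n → List (Pair n)
allPairs zero    = []
allPairs (suc n) = map pairWithZero (allFin n) ++ map liftPair (allPairs n)

-- Pascal's rule C(n+1,2) = n + C(n,2) counts the enumeration.
allPairs-length : ∀ n → length (allPairs n) ≡ n C 2
allPairs-length zero    = refl
allPairs-length (suc n) = begin
    length (map pairWithZero (allFin n) ++ map liftPair (allPairs n))
  ≡⟨ length-++ (map pairWithZero (allFin n)) ⟩
    length (map pairWithZero (allFin n)) + length (map liftPair (allPairs n))
  ≡⟨ cong₂ _+_ (trans (length-map pairWithZero (allFin n)) (length-tabulate (λ i → i)))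
               (trans (length-map liftPair (allPairs n)) (allPairs-length n)) ⟩
    n + n C 2
  ≡⟨ cong (_+ n C 2) (nC1≡n n) ⟨
    n C 1 + n C 2
  ≡⟨ nCk+nC[k+1]≡[n+1]C[k+1] n 1 ⟩
    suc n C 2 ∎
  where open ≡-Reasoning

∈-allPairs : ∀ {n} (q : Pair n) → q ∈ allPairs n
∈-allPairs {suc n} ⟪ fzero , fsuc j ∣ _ ⟫ =
  ∈-++⁺ˡ (subst (_∈ map pairWithZero (allFin n)) (pair-≡ refl refl) (∈-map⁺ pairWithZero (∈-allFin j)))
∈-allPairs {suc n} ⟪ fsuc x , fsuc y ∣ s≤s x<y ⟫ =
  ∈-++⁺ʳ (map pairWithZero (allFin n)) (∈-map⁺ liftPair (∈-allPairs ⟪ x , y ∣ x<y ⟫))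

allPairs-unique : ∀ n → Unique (allPairs n)
allPairs-unique zero    = []
allPairs-unique (suc n) =
  Uniqueₚ.++⁺ (Uniqueₚ.map⁺ (λ eq → suc-injective (cong snd eq)) (Uniqueₚ.allFin⁺ n))
              (Uniqueₚ.map⁺ liftPair-injective (allPairs-unique n))
              disjoint
  where
  liftPair-injective : ∀ {p q : Pair n} → liftPair p ≡ liftPair q → p ≡ q
  liftPair-injective {⟪ _ , _ ∣ _ ⟫} {⟪ _ , _ ∣ _ ⟫} eq =
    pair-≡ (suc-injective (cong fst eq)) (suc-injective (cong snd eq))
  disjoint : Disjoint (map pairWithZero (allFin n)) (map liftPair (allPairs n))
  disjoint (∈zero , ∈lift) with _ , _ , refl ← ∈-map⁻ pairWithZero ∈zero
                              | ⟪ _ , _ ∣ _ ⟫ , _ , () ← ∈-map⁻ liftPair ∈lift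

star : ∀ {n} → Fin n → List (Pair n)
star {n} a = filter (a ∈ᵖ?_) (allPairs n)

star-unique : ∀ {n} (a : Fin n) → Unique (star a)
star-unique {n} a = Uniqueₚ.filter⁺ (a ∈ᵖ?_) (allPairs-unique n)

-- Exactly n - 1 pairs pass through a point: `partner a` matches them with
-- the points other than a.
star-length : ∀ {n} (a : Fin n) → 1 + length (star a) ≡ n
star-length {n} a = begin
    1 + length (star a)                            ≡⟨ cong suc (length-map (partner a) (star a)) ⟨
    1 + length (map (partner a) (star a))          ≡⟨ cong suc partners-length ⟩
    1 + length (filter (∁? (_≟ᶠ a)) (allFin n))    ≡⟨ length-remove _≟ᶠ_ (Uniqueₚ.allFin⁺ n) (∈-allFin a) ⟩
    length (allFin n)                              ≡⟨ length-tabulate (λ i → i) ⟩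
    n                                              ∎
  where
  open ≡-Reasoning
  through-a : ∀ {q} → q ∈ star a → a ∈ᵖ q
  through-a q∈ = proj₂ (∈-filter⁻ (a ∈ᵖ?_) {xs = allPairs n} q∈)
  partners-unique : Unique (map (partner a) (star a))
  partners-unique = map-unique (partner a)
    (λ p∈ q∈ eq → ≐-injective (partner-≐ (through-a p∈))
                               (subst (λ x → _ ≐⟅ a , x ⟆) (sym eq) (partner-≐ (through-a q∈))))
    (star-unique a)
  partners⊆others : map (partner a) (star a) ⊆ filter (∁? (_≟ᶠ a)) (allFin n)
  partners⊆others x∈ with q , q∈ , refl ← ∈-map⁻ (partner a) x∈ =
    ∈-filter⁺ (∁? (_≟ᶠ a)) (∈-allFin _) (≐-distinct (partner-≐ (through-a q∈)) ∘′ sym)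
  others⊆partners : filter (∁? (_≟ᶠ a)) (allFin n) ⊆ map (partner a) (star a)
  others⊆partners {x} x∈ = subst (_∈ map (partner a) (star a)) (partner-unique ax≐)
    (∈-map⁺ (partner a) (∈-filter⁺ (a ∈ᵖ?_) (∈-allPairs _) (≐-∈ᵖ ax≐)))
    where
    a≢x : a ≢ x
    a≢x a≡x = proj₂ (∈-filter⁻ (∁? (_≟ᶠ a)) {xs = allFin n} x∈) (sym a≡x)
    ax≐ : ⟅ a , x ⟆ a≢x ≐⟅ a , x ⟆
    ax≐ = ⟅,⟆-≐ a x a≢x
  partners-length : length (map (partner a) (star a)) ≡ length (filter (∁? (_≟ᶠ a)) (allFin n))
  partners-length = same-elements⇒same-length partners-unique
    (Uniqueₚ.filter⁺ (∁? (_≟ᶠ a)) (Uniqueₚ.allFin⁺ n)) partners⊆others others⊆partners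

-- Arithmetic of the bound  C(n,2) + 2 - n

bound-from-avoided : ∀ {k s t n} → k + s ≤ t → 2 + s ≡ n → k ≤ (t + 2) ∸ n
bound-from-avoided {k} {s} {t} k+s≤t refl =
  subst (k ≤_) (trans (sym ([m+n]∸[m+o]≡n∸o 2 t s)) (cong (_∸ (2 + s)) (+-comm 2 t)))
        (m+n≤o⇒m≤o∸n k k+s≤t)

count-from-complement : ∀ {s r t n} → s + r ≡ t → 1 + s ≡ n → 1 + r ≡ (t + 2) ∸ n
count-from-complement {s} {r} refl refl = begin
    1 + r                       ≡⟨ m+n∸m≡n (1 + s) (1 + r) ⟨
    (1 + s) + (1 + r) ∸ (1 + s) ≡⟨ cong (_∸ (1 + s)) regroup ⟩
    (s + r + 2) ∸ (1 + s)       ∎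
  where
  open ≡-Reasoning
  regroup : (1 + s) + (1 + r) ≡ s + r + 2
  regroup = trans (cong suc (+-suc s r)) (+-comm 2 (s + r))

-- The induced action on pairs

module OnPairs {c ℓ} {G : Group c ℓ} {n : ℕ} (A : Action G n) where
  open Group G using (Carrier; _∙_; ε; _⁻¹; inverseˡ; identityˡ)
  open Action A

  π : Carrier → Fin n → Fin n
  π g i = act g ⟨$⟩ʳ i

  π-injective : ∀ g {x y} → π g x ≡ π g y → x ≡ y
  π-injective g {x} {y} eq = begin
    x                        ≡⟨ permutation-inverseˡ (act g) ⟨
    act g ⟨$⟩ˡ (π g x)       ≡⟨ cong (act g ⟨$⟩ˡ_) eq ⟩
    act g ⟨$⟩ˡ (π g y)       ≡⟨ permutation-inverseˡ (act g) ⟩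
    y                        ∎
    where open ≡-Reasoning

  π-ε : ∀ i → π ε i ≡ i
  π-ε i = π-injective ε (trans (sym (act-hom ε ε i)) (act-cong (identityˡ ε) i))

  π-inverse : ∀ g x → π (g ⁻¹) (π g x) ≡ x
  π-inverse g x = trans (sym (act-hom (g ⁻¹) g x)) (trans (act-cong (inverseˡ g) x) (π-ε x))

  infixr 6 _·ᵖ_
  _·ᵖ_ : Carrier → Pair n → Pair n
  g ·ᵖ p = ⟅ π g (fst p) , π g (snd p) ⟆ (fst≢snd p ∘′ π-injective g)

  ·ᵖ-≐ : ∀ g p → g ·ᵖ p ≐⟅ π g (fst p) , π g (snd p) ⟆
  ·ᵖ-≐ g p = ⟅,⟆-≐ _ _ _

  -- `MapsPair A g p q` says q ≐⟅ g (fst p) , g (snd p) ⟆.  (MapsPair is a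
  -- defined sum, so its indices cannot be inferred and are passed explicitly.)
  maps⇒≐ : ∀ g p q → MapsPair A g p q → q ≐⟅ π g (fst p) , π g (snd p) ⟆
  maps⇒≐ g p q (inj₁ (x≡ , y≡)) = in-order x≡ y≡
  maps⇒≐ g p q (inj₂ (x≡ , y≡)) = reversed x≡ y≡

  ≐⇒maps : ∀ g p q → q ≐⟅ π g (fst p) , π g (snd p) ⟆ → MapsPair A g p q
  ≐⇒maps g p q (in-order x≡ y≡) = inj₁ (x≡ , y≡)
  ≐⇒maps g p q (reversed x≡ y≡) = inj₂ (x≡ , y≡)

  _~_ : Rel (Pair n) c
  _~_ = SameOrbit A

  ~-refl : ∀ p → p ~ p
  ~-refl p = ε , inj₁ (π-ε (fst p) , π-ε (snd p))

  ~-sym : ∀ p q → p ~ q → q ~ p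
  ~-sym p q (g , p↦q) = g ⁻¹ , ≐⇒maps (g ⁻¹) q p (back (maps⇒≐ g p q p↦q))
    where
    back : q ≐⟅ π g (fst p) , π g (snd p) ⟆ → p ≐⟅ π (g ⁻¹) (fst q) , π (g ⁻¹) (snd q) ⟆
    back (in-order refl refl) = in-order (π-inverse g (fst p)) (π-inverse g (snd p))
    back (reversed refl refl) = reversed (π-inverse g (snd p)) (π-inverse g (fst p))

  ~-trans : ∀ p q r → p ~ q → q ~ r → p ~ r
  ~-trans p q r (g , p↦q) (h , q↦r) = h ∙ g , ≐⇒maps (h ∙ g) p r
    (subst₂ (r ≐⟅_,_⟆) (sym (act-hom h g (fst p))) (sym (act-hom h g (snd p)))
            (≐-image (π h) (maps⇒≐ g p q p↦q) (maps⇒≐ h q r q↦r)))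

  ~-isEquivalence : IsEquivalence _~_
  ~-isEquivalence = record
    { refl  = λ {p} → ~-refl p
    ; sym   = λ {p} {q} → ~-sym p q
    ; trans = λ {p} {q} {r} → ~-trans p q r
    }

  module MovedPoint (g : Carrier) (a : Fin n) (moved : π g a ≢ a) where
    b : Fin n
    b = π g a

    a≢b : a ≢ b
    a≢b a≡b = moved (sym a≡b)

    ab : Pair n
    ab = ⟅ a , b ⟆ a≢b

    Avoided : Pair n → Set
    Avoided p = a ∈ᵖ p × p ≢ ab

    avoided? : ∀ p → Dec (Avoided p)
    avoided? p = (a ∈ᵖ? p) ×-dec ¬? (p ≟ᵖ ab)

    avoided : List (Pair n)
    avoided = filter (∁? (_≟ᵖ ab)) (star a)

    -- |S| = (n - 1) - 1: the star of a minus {a , b}.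
    avoided-length : 2 + length avoided ≡ n
    avoided-length = trans (cong suc (length-remove _≟ᵖ_ (star-unique a) ab∈star)) (star-length a)
      where
      ab∈star : ab ∈ star a
      ab∈star = ∈-filter⁺ (a ∈ᵖ?_) (∈-allPairs ab) (≐-∈ᵖ (⟅,⟆-≐ a b a≢b))

    ∈avoided⇒Avoided : ∀ {p} → p ∈ avoided → Avoided p
    ∈avoided⇒Avoided p∈ with p∈star , p≢ab ← ∈-filter⁻ (∁? (_≟ᵖ ab)) {xs = star a} p∈ =
      proj₂ (∈-filter⁻ (a ∈ᵖ?_) {xs = allPairs n} p∈star) , p≢ab

    push : Pair n → Pair n
    push p with avoided? p
    ... | yes _ = g ·ᵖ p
    ... | no  _ = p

    push-stays : ∀ p → p ~ push p
    push-stays p with avoided? p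
    ... | yes _ = g , ≐⇒maps g p (g ·ᵖ p) (·ᵖ-≐ g p)
    ... | no  _ = ~-refl p

    -- g p contains b = g a; were it also to contain a, it would be {a , b}.
    push-avoids : ∀ p → ¬ Avoided (push p)
    push-avoids p with avoided? p
    ... | no  ¬avoided   = ¬avoided
    ... | yes (a∈p , _) = λ (a∈gp , gp≢ab) →
      gp≢ab (≐-injective (∈ᵖ-both a∈gp (≐-image-∈ᵖ (π g) {q = p} (·ᵖ-≐ g p) a∈p) a≢b) (⟅,⟆-≐ a b a≢b))

    orbit-bound : ∀ k → HasPairOrbitCount A k → k ≤ pairBound n
    orbit-bound k (reps , refl , separated , _) = bound-from-avoided
      (subst (length reps + length avoided ≤_) (allPairs-length n)
        (classes+avoided≤ ~-isEquivalence push push-stays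
          (λ p p∈ → push-avoids p (∈avoided⇒Avoided p∈))
          separated (Uniqueₚ.filter⁺ (∁? (_≟ᵖ ab)) (star-unique a)) ∈-allPairs))
      avoided-length

  module Transposition (a b : Fin n) (a≢b : a ≢ b)
                       (image : ∀ g → ActsTrivially g ⊎ (∀ i → π g i ≡ transpose a b ⟨$⟩ʳ i))
                       (gτ : Carrier) (gτ-is-τ : ∀ i → π gτ i ≡ transpose a b ⟨$⟩ʳ i) where
    τ : Fin n → Fin n
    τ = Components.transpose a b

    τ-a : τ a ≡ b
    τ-a rewrite dec-true (a ≟ᶠ a) refl = refl

    τ-fix : ∀ {x} → x ≢ a → x ≢ b → τ x ≡ x
    τ-fix {x} x≢a x≢b rewrite dec-false (x ≟ᶠ a) x≢a | dec-false (x ≟ᶠ b) x≢b = refl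

    ab : Pair n
    ab = ⟅ a , b ⟆ a≢b

    ab≐ : ab ≐⟅ a , b ⟆
    ab≐ = ⟅,⟆-≐ a b a≢b

    avoiding-b : List (Pair n)
    avoiding-b = filter (∁? (b ∈ᵖ?_)) (allPairs n)

    representatives : List (Pair n)
    representatives = ab ∷ avoiding-b

    Representative : Pair n → Set
    Representative p = p ≡ ab ⊎ ¬ b ∈ᵖ p

    through-b⇒ab : ∀ {q} → Representative q → b ∈ᵖ q → q ≡ ab
    through-b⇒ab (inj₁ q≡ab)  _   = q≡ab
    through-b⇒ab (inj₂ b∉q) b∈q = contradiction b∈q b∉q

    τ-separates : ∀ {p q} → Representative p → Representative q →
                  q ≐⟅ τ (fst p) , τ (snd p) ⟆ → p ≡ q
    τ-separates {p} {q} (inj₁ refl) q-rep q≐ =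
      sym (through-b⇒ab q-rep (subst (_∈ᵖ q) τ-a (≐-∈ᵖ (≐-image τ ab≐ q≐))))
    τ-separates {p} {q} (inj₂ b∉p) q-rep q≐ with a ∈ᵖ? p
    ... | no a∉p = ≐-injective (≐-refl p)
                   (subst₂ (q ≐⟅_,_⟆) (τ-fix (a∉p ∘′ inj₁ ∘′ sym) (b∉p ∘′ inj₁ ∘′ sym))
                                     (τ-fix (a∉p ∘′ inj₂ ∘′ sym) (b∉p ∘′ inj₂ ∘′ sym)) q≐)
    ... | yes a∈p = contradiction (≐-points ab≐ (≐-∈ᵖ (≐-swap bx≐))) x∉ab
      where
      x : Fin n
      x = partner a p
      ax≐ : p ≐⟅ a , x ⟆
      ax≐ = partner-≐ a∈p
      x≢a : x ≢ a
      x≢a x≡a = ≐-distinct ax≐ (sym x≡a)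
      x≢b : x ≢ b
      x≢b x≡b = b∉p (subst (_∈ᵖ p) x≡b (≐-∈ᵖ (≐-swap ax≐)))
      x∉ab : ¬ (x ≡ a ⊎ x ≡ b)
      x∉ab (inj₁ x≡a) = x≢a x≡a
      x∉ab (inj₂ x≡b) = x≢b x≡b
      qbx≐ : q ≐⟅ b , x ⟆
      qbx≐ = subst₂ (q ≐⟅_,_⟆) τ-a (τ-fix x≢a x≢b) (≐-image τ ax≐ q≐)
      bx≐ : ab ≐⟅ b , x ⟆
      bx≐ = subst (_≐⟅ b , x ⟆) (through-b⇒ab q-rep (≐-∈ᵖ qbx≐)) qbx≐

    -- Representatives in one orbit coincide, since every g acts as id or as τ.
    representatives-rigid : ∀ {p q} → Representative p → Representative q → p ~ q → p ≡ q
    representatives-rigid {p} {q} p-rep q-rep (g , p↦q) with image g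
    ... | inj₁ trivial = ≐-injective (≐-refl p)
                           (subst₂ (q ≐⟅_,_⟆) (trivial (fst p)) (trivial (snd p)) (maps⇒≐ g p q p↦q))
    ... | inj₂ g-is-τ  = τ-separates p-rep q-rep
                           (subst₂ (q ≐⟅_,_⟆) (g-is-τ (fst p)) (g-is-τ (snd p)) (maps⇒≐ g p q p↦q))

    ∈avoiding-b : ∀ {p} → p ∈ avoiding-b → ¬ b ∈ᵖ p
    ∈avoiding-b p∈ = proj₂ (∈-filter⁻ (∁? (b ∈ᵖ?_)) {xs = allPairs n} p∈)

    representatives-unique : Unique representatives
    representatives-unique =
      All.tabulate (λ p∈ ab≡p → ∈avoiding-b p∈ (subst (b ∈ᵖ_) ab≡p (≐-∈ᵖ (≐-swap ab≐))))
      ∷ Uniqueₚ.filter⁺ (∁? (b ∈ᵖ?_)) (allPairs-unique n)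

    representatives-separated : AllPairs (λ p q → ¬ p ~ q) representatives
    representatives-separated = unique⇒separated ~-isEquivalence representatives-rigid
      (inj₁ refl ∷ All.tabulate (inj₂ ∘′ ∈avoiding-b)) representatives-unique

    -- A pair {b , x} with x ≠ a is the τ-image of the representative {a , x}.
    representatives-cover : ∀ q → Any (_~ q) representatives
    representatives-cover q with b ∈ᵖ? q
    ... | no b∉q = there (lose (∈-filter⁺ (∁? (b ∈ᵖ?_)) (∈-allPairs q) b∉q) (~-refl q))
    ... | yes b∈q with partner b q ≟ᶠ a
    ...   | yes refl = here (subst (_~ q) (≐-injective (≐-swap (partner-≐ b∈q)) ab≐) (~-refl q))
    ...   | no x≢a = there (lose (∈-filter⁺ (∁? (b ∈ᵖ?_)) (∈-allPairs ax) b∉ax) (gτ , ax↦q))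
      where
      x : Fin n
      x = partner b q
      x≢b : x ≢ b
      x≢b x≡b = ≐-distinct (partner-≐ b∈q) (sym x≡b)
      a≢x : a ≢ x
      a≢x a≡x = x≢a (sym a≡x)
      ax : Pair n
      ax = ⟅ a , x ⟆ a≢x
      ax≐ : ax ≐⟅ a , x ⟆
      ax≐ = ⟅,⟆-≐ a x a≢x
      b∉ax : ¬ b ∈ᵖ ax
      b∉ax b∈ax with ≐-points ax≐ b∈ax
      ... | inj₁ b≡a = a≢b (sym b≡a)
      ... | inj₂ b≡x = x≢b (sym b≡x)
      q≐τ : q ≐⟅ τ a , τ x ⟆
      q≐τ = subst₂ (q ≐⟅_,_⟆) (sym τ-a) (sym (τ-fix x≢a x≢b)) (partner-≐ b∈q)
      ax↦q : MapsPair A gτ ax q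
      ax↦q = ≐⇒maps gτ ax q (subst₂ (q ≐⟅_,_⟆) (sym (gτ-is-τ (fst ax))) (sym (gτ-is-τ (snd ax)))
                             (≐-image⁻ τ ax≐ q≐τ))

    representatives-length : length representatives ≡ pairBound n
    representatives-length = count-from-complement
      (trans (length-filter-∁ (b ∈ᵖ?_) (allPairs n)) (allPairs-length n)) (star-length b)

    orbit-count : HasPairOrbitCount A (pairBound n)
    orbit-count =
      representatives , representatives-length , representatives-separated , representatives-cover

lemma3 : ∀ {c ℓ} (G : Group c ℓ) (n : ℕ) (A : Action G n)
         → IsFiniteGroup G
         → Action.Faithful A
         → Action.Nontrivial A
         → (∀ k → HasPairOrbitCount A k → k ≤ pairBound n)
           × (ImageGeneratedByTransposition A → HasPairOrbitCount A (pairBound n))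
lemma3 G n A _ _ (g , g-nontrivial) = upper-bound , sharpness
  where
  open OnPairs A
  moved-point : ∃ λ a → π g a ≢ a
  moved-point = ¬∀⟶∃¬ n (λ i → π g i ≡ i) (λ i → π g i ≟ᶠ i) g-nontrivial
  upper-bound : ∀ k → HasPairOrbitCount A k → k ≤ pairBound n
  upper-bound = MovedPoint.orbit-bound g (proj₁ moved-point) (proj₂ moved-point)
  sharpness : ImageGeneratedByTransposition A → HasPairOrbitCount A (pairBound n)
  sharpness (a , b , a≢b , image , gτ , gτ-is-τ) = Transposition.orbit-count a b a≢b image gτ gτ-is-τ
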